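{- There is an absolute constant $c>0$ such that the following holds. For every real $0<\alpha<1$ and every infinite sequence $\mathcal{A}$ of positive integers with $d^{*}(\mathcal{A})>\alpha$, writing $\mathcal{B}=\mathcal{A}\cdot\mathcal{A}=\{b_1<b_2<\cdots\}$, we have $b_{n+1}-b_n\le c\,\alpha^{ -3}$ for infinitely many $n$.
   Context: For an infinite set $\mathcal{A}$ of positive integers, the upper Banach density is $d^{*}(\mathcal{A})=\limsup_{|I|\to\infty}\frac{|\mathcal{A}\cap I|}{|I|}$, where $I$ runs through all intervals of integers. The product set $\mathcal{A}\cdot\mathcal{A}$ is the set of all products $a_ia_j$ with $a_i,a_j\in\mathcal{A}$, and $b_1<b_2<\cdots$ denotes its elements in increasing order. -}

module Defs where

open import Data.Nat as ℕ using (ℕ; suc; _∸_)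
open import Data.Product using (Σ; ∃; _×_; _,_)
open import Data.Rational as ℚ using (ℚ)
import Data.Integer as ℤ
open import Relation.Nullary using (¬_)
open import Relation.Binary.PropositionalEquality using (_≡_)

-- An infinite sequence of positive integers a₀ < a₁ < a₂ < …,
-- represented by its increasing enumeration; 𝒜 = { a i | i ∈ ℕ }.
StrictlyIncreasing : (ℕ → ℕ) → Set
StrictlyIncreasing a = ∀ i → a i ℕ.< a (suc i)

Positive : (ℕ → ℕ) → Set
Positive a = ∀ i → 1 ℕ.≤ a i

⟦_⟧ : ℕ → ℚ
⟦ n ⟧ = ℤ.+ n ℚ./ 1

-- "at least k elements of 𝒜 lie in the interval [x, x + L)":
-- there are k consecutive terms a i, …, a (i + k - 1) in it (k ≥ 1),
-- or k = 0.
AtLeastInInterval : (ℕ → ℕ) → (k x L : ℕ) → Set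
AtLeastInInterval a ℕ.zero x L = ℕ.zero ≡ ℕ.zero
AtLeastInInterval a (suc k) x L =
  ∃ λ i → (x ℕ.≤ a i) × (a (i ℕ.+ k) ℕ.< x ℕ.+ L)

-- d*(𝒜) > α, i.e. limsup_{|I|→∞} |𝒜 ∩ I|/|I| > α, written out:
-- there is β > α such that for every N there is an interval I = [x, x+L)
-- with |I| = L ≥ N and |𝒜 ∩ I| > β·|I|.
UpperBanachDensityGt : (ℕ → ℕ) → ℚ → Set
UpperBanachDensityGt a α =
  ∃ λ (β : ℚ) → (α ℚ.< β) ×
    (∀ (N : ℕ) → ∃ λ (x : ℕ) → ∃ λ (L : ℕ) → ∃ λ (k : ℕ) →
       (N ℕ.≤ L) × (1 ℕ.≤ L) × AtLeastInInterval a k x L × (β ℚ.* ⟦ L ⟧ ℚ.< ⟦ k ⟧))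

InProd : (ℕ → ℕ) → ℕ → Set
InProd a b = ∃ λ i → ∃ λ j → b ≡ a i ℕ.* a j

-- b < b' are consecutive elements of 𝒜·𝒜, i.e. b = b_n, b' = b_{n+1}
-- for some n.
Consecutive : (ℕ → ℕ) → ℕ → ℕ → Set
Consecutive a b b' =
  InProd a b × InProd a b' × (b ℕ.< b') ×
  (∀ d → InProd a d → ¬ ((b ℕ.< d) × (d ℕ.< b')))

module Submission where

-- Write α = p/q and choose G with 4q < Gp ≤ 5q (scale).  Let g_r = a_{r+1} - a_r.
--  * Pigeonhole (small-values): among 2G positive numbers either some value
--    ≤ G occurs twice, or at least G of them exceed G.
--  * Twin gaps (twin-gaps): g_r = g_s = d with r < s gives the two products
--    a_r a_{s+1} < a_{r+1} a_s, which differ by exactly d (a_s - a_r).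
--  * Hence (block, blocks) either two elements of 𝒜·𝒜 above a_j lie within G³
--    of each other, or every block of 2G terms from a_j on spans at least G².
--  * An interval of length L with more than 4L/G terms, which d*(𝒜) > α
--    provides, excludes the second case (dense-interval⇒close-pair).
--  * Membership in 𝒜·𝒜 is decidable, so a least-element search turns two close
--    products into consecutive ones (close-pair⇒consecutive).
-- Finally (b' - b)·α³ ≤ (Gp/q)³ ≤ 125, transferred to ℚ via fractions of
-- naturals (fraction-cube-≤).

open import Defs
open import Data.Nat
open import Data.Nat.Properties
open import Data.Nat.DivMod using (m≡m%n+[m/n]*n; m%n<n; m/n*n≤m)
open import Data.Nat.Solver using (module +-*-Solver)
open import Data.Bool.Base using (if_then_else_)
open import Data.Product using (∃; ∃₂; _×_; _,_)
open import Data.Sum using (_⊎_; inj₁; inj₂)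
open import Data.Empty using (⊥-elim)
open import Function using (_∘_)
open import Relation.Nullary using (¬_; Dec; yes; no; does)
open import Relation.Nullary.Decidable using (map′; dec-true; dec-false; _×-dec_)
open import Relation.Unary using (Decidable)
open import Relation.Binary.PropositionalEquality
open import Relation.Binary using (tri<; tri≈; tri>)
open import Data.Nat.Coprimality using (Coprime)
import Data.Integer as ℤ
import Data.Integer.Properties as ℤP
open import Data.Rational as ℚ using (ℚ; mkℚ; 0ℚ; 1ℚ; toℚᵘ)
import Data.Rational.Properties as ℚP
open import Data.Rational.Unnormalised as ℚᵘ using (ℚᵘ; *≤*; *<*)
import Data.Rational.Unnormalised.Properties as ℚᵘP

open import Algebra.Properties.CommutativeSemigroup +-commutativeSemigroup using (interchange)

open +-*-Solver using (solve; _:+_; _:*_; _:=_; con)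

module _ {P : ℕ → Set} (P? : Decidable P) where

  least : ∀ {n} → P n → ∃ λ m → m ≤ n × P m × (∀ {k} → k < m → ¬ P k)
  least {n} = scan n 0 refl λ ()
    where
    scan : ∀ d b → b + d ≡ n → (∀ {k} → k < b → ¬ P k) → P n →
           ∃ λ m → m ≤ n × P m × (∀ {k} → k < m → ¬ P k)
    scan d b b+d≡n below pn with P? b
    ... | yes pb = b , subst (b ≤_) b+d≡n (m≤m+n b d) , pb , below
    scan zero b b+0≡n below pn | no ¬pb =
      ⊥-elim (¬pb (subst P (trans (sym b+0≡n) (+-identityʳ b)) pn))
    scan (suc d) b b+d≡n below pn | no ¬pb =
      scan d (suc b) (trans (sym (+-suc b d)) b+d≡n) below′ pn
      where
      below′ : ∀ {k} → k < suc b → ¬ P k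
      below′ k<1+b with m<1+n⇒m<n∨m≡n k<1+b
      ... | inj₁ k<b = below k<b
      ... | inj₂ refl = ¬pb

module _ {P : ℕ → Set} (P? : Decidable P) where

  next-element : ∀ {b₁ b₂} → P b₂ → b₁ < b₂ →
                 ∃ λ b' → b' ≤ b₂ × P b' × b₁ < b' × (∀ d → P d → ¬ (b₁ < d × d < b'))
  next-element {b₁} pb₂ b₁<b₂ with least (λ c → b₁ <? c ×-dec P? c) (b₁<b₂ , pb₂)
  ... | b' , b'≤b₂ , (b₁<b' , pb') , minimal =
    b' , b'≤b₂ , pb' , b₁<b' , λ d pd (b₁<d , d<b') → minimal d<b' (b₁<d , pd)

indicator : {A : Set} → Dec A → ℕ
indicator d = if does d then 1 else 0

count : {P : ℕ → Set} → Decidable P → ℕ → ℕ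
count P? zero = zero
count P? (suc n) = count P? n + indicator (P? n)

module _ {P : ℕ → Set} (P? : Decidable P) where

  count-suc-yes : ∀ {n} → P n → count P? (suc n) ≡ count P? n + 1
  count-suc-yes {n} pn rewrite dec-true (P? n) pn = refl

  count-suc-no : ∀ {n} → ¬ P n → count P? (suc n) ≡ count P? n
  count-suc-no {n} ¬pn rewrite dec-false (P? n) ¬pn = +-identityʳ (count P? n)

  count-all : (∀ t → P t) → ∀ n → count P? n ≡ n
  count-all all zero = refl
  count-all all (suc n) with P? n
  ... | yes _ = trans (+-comm (count P? n) 1) (cong suc (count-all all n))
  ... | no ¬pn = ⊥-elim (¬pn (all n))

  count-one : ∀ n → 1 ≤ count P? n → ∃ λ t → t < n × P t
  count-one zero ()
  count-one (suc n) one with P? n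
  ... | yes pn = n , ≤-refl , pn
  ... | no _ = let t , t<n , pt = count-one n (subst (1 ≤_) (+-identityʳ _) one)
               in t , m≤n⇒m≤1+n t<n , pt

  count-two : ∀ n → 2 ≤ count P? n → ∃₂ λ t t' → t < t' × t' < n × P t × P t'
  count-two zero ()
  count-two (suc n) two with P? n
  ... | yes pn = let t , t<n , pt = count-one n (+-cancelʳ-≤ 1 1 (count P? n) two)
                 in t , n , t<n , ≤-refl , pt , pn
  ... | no _ = let t , t' , t<t' , t'<n , pt , pt' = count-two n (subst (2 ≤_) (+-identityʳ _) two)
               in t , t' , t<t' , m≤n⇒m≤1+n t'<n , pt , pt'

count-+ : {P Q R : ℕ → Set} (P? : Decidable P) (Q? : Decidable Q) (R? : Decidable R) →
          (∀ t → indicator (P? t) ≡ indicator (Q? t) + indicator (R? t)) →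
          ∀ n → count P? n ≡ count Q? n + count R? n
count-+ P? Q? R? split zero = refl
count-+ P? Q? R? split (suc n) = begin
  count P? n + indicator (P? n)                                      ≡⟨ cong₂ _+_ (count-+ P? Q? R? split n) (split n) ⟩
  (count Q? n + count R? n) + (indicator (Q? n) + indicator (R? n))  ≡⟨ interchange (count Q? n) (count R? n) _ _ ⟩
  (count Q? n + indicator (Q? n)) + (count R? n + indicator (R? n))  ∎
  where open ≡-Reasoning

RepeatedSmall : (ℕ → ℕ) → ℕ → ℕ → Set
RepeatedSmall f G n = ∃₂ λ t t' → t < t' × t' < n × f t ≡ f t' × f t ≤ G

count-above : (ℕ → ℕ) → ℕ → ℕ → ℕ
count-above f G = count (λ t → G <? f t)

above-split : ∀ G x → indicator (G <? x) ≡ indicator (suc G <? x) + indicator (x ≟ suc G)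
above-split G x with <-cmp x (suc G)
... | tri< x<1+G _ _ rewrite dec-false (G <? x) (<⇒≱ x<1+G) | dec-false (suc G <? x) (<-asym x<1+G)
                           | dec-false (x ≟ suc G) (<⇒≢ x<1+G) = refl
... | tri≈ _ refl _ rewrite dec-true (G <? suc G) ≤-refl | dec-false (suc G <? suc G) (<-irrefl refl)
                          | dec-true (suc G ≟ suc G) refl = refl
... | tri> _ _ 1+G<x rewrite dec-true (G <? x) (<-trans (n<1+n G) 1+G<x) | dec-true (suc G <? x) 1+G<x
                           | dec-false (x ≟ suc G) (>⇒≢ 1+G<x) = refl

small-values : (f : ℕ → ℕ) → (∀ t → 1 ≤ f t) → ∀ G n → RepeatedSmall f G n ⊎ n ≤ G + count-above f G n
small-values f f-pos zero n = inj₂ (≤-reflexive (sym (count-all (λ t → 0 <? f t) f-pos n)))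
small-values f f-pos (suc G) n with small-values f f-pos G n
... | inj₁ (t , t' , t<t' , t'<n , eq , small) = inj₁ (t , t' , t<t' , t'<n , eq , m≤n⇒m≤1+n small)
... | inj₂ n≤G+above with count (λ t → f t ≟ suc G) n ≤? 1
...   | yes once = inj₂ (begin
  n                                                           ≤⟨ n≤G+above ⟩
  G + count-above f G n                                       ≡⟨ cong (G +_) (count-+ _ _ _ (above-split G ∘ f) n) ⟩
  G + (count-above f (suc G) n + count (λ t → f t ≟ suc G) n) ≤⟨ +-monoʳ-≤ G (+-monoʳ-≤ (count-above f (suc G) n) once) ⟩
  G + (count-above f (suc G) n + 1)                           ≡⟨ cong (G +_) (+-comm _ 1) ⟩
  G + suc (count-above f (suc G) n)                           ≡⟨ +-suc G _ ⟩
  suc G + count-above f (suc G) n                             ∎)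
  where open ≤-Reasoning
...   | no twice with count-two (λ t → f t ≟ suc G) n (≰⇒> twice)
...     | t , t' , t<t' , t'<n , ft≡ , ft'≡ = inj₁ (t , t' , t<t' , t'<n , trans ft≡ (sym ft'≡) , ≤-reflexive ft≡)

-- The final count: if the m blocks of 2G terms that fit into an interval of
-- length L each span at least G², then the interval holds fewer than 4L/G terms.
too-few-terms : ∀ G L k m M → G * G + G * M ≤ L → m * (G * G) < L → suc k ≤ suc m * (G + G) + M → G * suc k < 4 * L
too-few-terms G L k m M room few enough = begin-strict
  G * suc k                                   ≤⟨ *-monoʳ-≤ G enough ⟩
  G * (suc m * (G + G) + M)                   ≡⟨ solve 3 (λ G m M → G :* ((con 1 :+ m) :* (G :+ G) :+ M) := con 2 :* (m :* (G :* G)) :+ (con 2 :* (G :* G) :+ G :* M)) refl G m M ⟩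
  2 * (m * (G * G)) + (2 * (G * G) + G * M)   <⟨ +-mono-<-≤ (*-monoʳ-< 2 few) (≤-trans (m≤m+n _ (G * M)) (≤-trans (≤-reflexive double) (*-monoʳ-≤ 2 room))) ⟩
  2 * L + 2 * L                               ≡⟨ solve 1 (λ L → con 2 :* L :+ con 2 :* L := con 4 :* L) refl L ⟩
  4 * L                                       ∎
  where
  open ≤-Reasoning
  double : 2 * (G * G) + G * M + G * M ≡ 2 * (G * G + G * M)
  double = solve 2 (λ G M → con 2 :* (G :* G) :+ G :* M :+ G :* M := con 2 :* (G :* G :+ G :* M)) refl G M

module _ (a : ℕ → ℕ) (a-inc : StrictlyIncreasing a) (a-pos : Positive a) where

  a-mono : ∀ {i j} → i ≤ j → a i ≤ a j
  a-mono {j = zero} z≤n = ≤-refl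
  a-mono {j = suc j} i≤1+j with m≤n⇒m<n∨m≡n i≤1+j
  ... | inj₁ i<1+j = ≤-trans (a-mono (m<1+n⇒m≤n i<1+j)) (<⇒≤ (a-inc j))
  ... | inj₂ refl = ≤-refl

  a-strict : ∀ {i j} → i < j → a i < a j
  a-strict {i} i<j = <-≤-trans (a-inc i) (a-mono i<j)

  index<term : ∀ i → i < a i
  index<term zero = a-pos 0
  index<term (suc i) = ≤-<-trans (index<term i) (a-inc i)

  -- membership in 𝒜·𝒜 is decidable: both indices are below the product
  InProd? : Decidable (InProd a)
  InProd? b = map′ (λ (i , _ , j , _ , e) → i , j , e) (λ (i , j , e) → i , bound-left i j e , j , bound-right i j e , e)
                   (anyUpTo? (λ i → anyUpTo? (λ j → b ≟ a i * a j) b) b)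
    where
    bound-left : ∀ i j → b ≡ a i * a j → i < b
    bound-left i j refl = <-≤-trans (index<term i) (m≤m*n (a i) (a j) {{>-nonZero (a-pos j)}})
    bound-right : ∀ i j → b ≡ a i * a j → j < b
    bound-right i j refl = <-≤-trans (index<term j) (m≤n*m (a j) (a i) {{>-nonZero (a-pos i)}})

  ClosePair : ℕ → ℕ → Set
  ClosePair D m = ∃₂ λ b₁ b₂ → InProd a b₁ × InProd a b₂ × b₁ < b₂ × b₂ ≤ b₁ + D × m ≤ b₁

  close-pair-≤ : ∀ {D m m'} → m' ≤ m → ClosePair D m → ClosePair D m'
  close-pair-≤ m'≤m (b₁ , b₂ , p₁ , p₂ , b₁<b₂ , close , m≤b₁) = b₁ , b₂ , p₁ , p₂ , b₁<b₂ , close , ≤-trans m'≤m m≤b₁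

  close-pair⇒consecutive : ∀ {D m} → ClosePair D m → ∃₂ λ b b' → m ≤ b × Consecutive a b b' × b' ∸ b ≤ D
  close-pair⇒consecutive (b₁ , b₂ , p₁ , p₂ , b₁<b₂ , close , m≤b₁) with next-element InProd? p₂ b₁<b₂
  ... | b' , b'≤b₂ , p' , b₁<b' , nothing-between =
    b₁ , b' , m≤b₁ , (p₁ , p' , b₁<b' , nothing-between) , m≤n+o⇒m∸n≤o b' b₁ (≤-trans b'≤b₂ close)

  gap : ℕ → ℕ
  gap r = a (suc r) ∸ a r

  a-suc : ∀ r → a (suc r) ≡ a r + gap r
  a-suc r = sym (m+[n∸m]≡n (<⇒≤ (a-inc r)))

  a-step : ∀ j n → a (j + suc n) ≡ a (j + n) + gap (j + n)
  a-step j n = trans (cong a (+-suc j n)) (a-suc (j + n))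

  gap-pos : ∀ r → 1 ≤ gap r
  gap-pos r = m<n⇒0<n∸m (a-inc r)

  twin-gaps : ∀ {r s} → r ≤ s → gap r ≡ gap s → a (suc r) * a s ≡ a r * a (suc s) + gap r * (a s ∸ a r)
  twin-gaps {r} {s} r≤s same = begin
    a (suc r) * a s                      ≡⟨ cong₂ _*_ (a-suc r) a-s ⟩
    (x + d) * (x + e)                    ≡⟨ solve 3 (λ x d e → (x :+ d) :* (x :+ e) := x :* ((x :+ e) :+ d) :+ d :* e) refl x d e ⟩
    x * ((x + e) + d) + d * e            ≡⟨ cong (λ y → x * y + d * e) (sym a-suc-s) ⟩
    a r * a (suc s) + gap r * (a s ∸ a r) ∎
    where
    open ≡-Reasoning
    x = a r
    d = gap r
    e = a s ∸ a r
    a-s : a s ≡ x + e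
    a-s = sym (m+[n∸m]≡n (a-mono r≤s))
    a-suc-s : a (suc s) ≡ (x + e) + d
    a-suc-s = trans (a-suc s) (cong₂ _+_ a-s (sym same))

  twin-gaps⇒close-pair : ∀ {D r s} → r < s → gap r ≡ gap s → gap r * (a s ∸ a r) ≤ D → ClosePair D (a r)
  twin-gaps⇒close-pair {r = r} {s} r<s same small =
    b₁ , a (suc r) * a s , (r , suc s , refl) , (suc r , s , refl) ,
    subst (b₁ <_) (sym product-gap) (m<m+n b₁ (*-mono-≤ (gap-pos r) (m<n⇒0<n∸m (a-strict r<s)))) ,
    ≤-trans (≤-reflexive product-gap) (+-monoʳ-≤ b₁ small) ,
    m≤m*n (a r) (a (suc s)) {{>-nonZero (a-pos (suc s))}}
    where
    b₁ = a r * a (suc s)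
    product-gap : a (suc r) * a s ≡ b₁ + gap r * (a s ∸ a r)
    product-gap = twin-gaps (<⇒≤ r<s) same

  module _ (G : ℕ) where

    gaps-from : ℕ → ℕ → ℕ
    gaps-from j t = gap (j + t)

    span : ∀ j n → a j + suc G * count-above (gaps-from j) G n ≤ a (j + n)
    span j zero = ≤-reflexive (trans (cong (a j +_) (*-zeroʳ G)) (trans (+-identityʳ (a j)) (cong a (sym (+-identityʳ j)))))
    span j (suc n) with G <? gap (j + n)
    ... | yes large = begin
      a j + suc G * count-above (gaps-from j) G (suc n) ≡⟨ cong (λ c → a j + suc G * c) (count-suc-yes (λ t → G <? gaps-from j t) large) ⟩
      a j + suc G * (c + 1)               ≡⟨ cong (a j +_) (trans (*-distribˡ-+ (suc G) c 1) (cong (suc G * c +_) (*-identityʳ (suc G)))) ⟩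
      a j + (suc G * c + suc G)           ≡⟨ sym (+-assoc (a j) _ _) ⟩
      a j + suc G * c + suc G             ≤⟨ +-mono-≤ (span j n) large ⟩
      a (j + n) + gap (j + n)             ≡⟨ sym (a-step j n) ⟩
      a (j + suc n)                       ∎
      where
      open ≤-Reasoning
      c = count-above (gaps-from j) G n
    ... | no small = begin
      a j + suc G * count-above (gaps-from j) G (suc n) ≡⟨ cong (λ c → a j + suc G * c) (count-suc-no (λ t → G <? gaps-from j t) small) ⟩
      a j + suc G * count-above (gaps-from j) G n       ≤⟨ span j n ⟩
      a (j + n)                                         ≤⟨ m≤m+n _ _ ⟩
      a (j + n) + gap (j + n)                           ≡⟨ sym (a-step j n) ⟩
      a (j + suc n)                                     ∎
      where open ≤-Reasoning

    block : ∀ j → ClosePair (G * (G * G)) (a j) ⊎ a j + G * G ≤ a (j + (G + G))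
    block j with a j + G * G ≤? a (j + (G + G))
    ... | yes grows = inj₂ grows
    ... | no ¬grows with small-values (gaps-from j) (gap-pos ∘ (j +_)) G (G + G)
    ...   | inj₂ few-small = ⊥-elim (¬grows (begin
      a j + G * G                                       ≤⟨ +-monoʳ-≤ (a j) (*-mono-≤ (n≤1+n G) (+-cancelˡ-≤ G G _ few-small)) ⟩
      a j + suc G * count-above (gaps-from j) G (G + G) ≤⟨ span j (G + G) ⟩
      a (j + (G + G))                                   ∎))
      where open ≤-Reasoning
    ...   | inj₁ (t , t' , t<t' , t'<2G , same , small) =
      inj₁ (close-pair-≤ (a-mono (m≤m+n j t))
        (twin-gaps⇒close-pair (+-monoʳ-< j t<t') same (*-mono-≤ small (<⇒≤ spread<G²))))
      where
      spread<G² : a (j + t') ∸ a (j + t) < G * G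
      spread<G² = ≤-<-trans (∸-mono (a-mono (+-monoʳ-≤ j (<⇒≤ t'<2G))) (a-mono (m≤m+n j t)))
                            (+-cancelˡ-< (a j) _ _ (subst (_< a j + G * G) (sym (m+[n∸m]≡n (a-mono (m≤m+n j (G + G))))) (≰⇒> ¬grows)))

    blocks : ∀ m j → ClosePair (G * (G * G)) (a j) ⊎ a j + m * (G * G) ≤ a (j + m * (G + G))
    blocks zero j = inj₂ (≤-reflexive (trans (+-identityʳ (a j)) (cong a (sym (+-identityʳ j)))))
    blocks (suc m) j with block j
    ... | inj₁ close = inj₁ close
    ... | inj₂ grows with blocks m (j + (G + G))
    ...   | inj₁ close = inj₁ (close-pair-≤ (a-mono (m≤m+n j (G + G))) close)
    ...   | inj₂ grows′ = inj₂ (begin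
      a j + (G * G + m * (G * G))       ≡⟨ sym (+-assoc (a j) _ _) ⟩
      a j + G * G + m * (G * G)         ≤⟨ +-monoˡ-≤ _ grows ⟩
      a (j + (G + G)) + m * (G * G)     ≤⟨ grows′ ⟩
      a (j + (G + G) + m * (G + G))     ≡⟨ cong a (+-assoc j (G + G) _) ⟩
      a (j + (G + G + m * (G + G)))     ∎)
      where open ≤-Reasoning

  dense-interval⇒close-pair : ∀ G M x L k → G * G + G * M ≤ L → AtLeastInInterval a (suc k) x L →
                              4 * L < G * suc k → ClosePair (G * (G * G)) M
  dense-interval⇒close-pair G@(suc _) M x L k room (i , x≤aᵢ , aᵢ₊ₖ<x+L) dense with M ≤? k
  ... | no k≱M = ⊥-elim (<⇒≱ dense (begin
    G * suc k        ≤⟨ *-monoʳ-≤ G (≰⇒> k≱M) ⟩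
    G * M            ≤⟨ m≤n+m (G * M) (G * G) ⟩
    G * G + G * M    ≤⟨ room ⟩
    L                ≤⟨ m≤m+n L (3 * L) ⟩
    4 * L            ∎))
    where open ≤-Reasoning
  ... | yes M≤k with blocks G ((k ∸ M) / (G + G)) (i + M)
  ...   | inj₁ close = close-pair-≤ (≤-trans (m≤n+m M i) (<⇒≤ (index<term (i + M)))) close
  ...   | inj₂ grows = ⊥-elim (<-asym dense (too-few-terms G L k m M room few-blocks enough-blocks))
    where
    j = i + M
    n = k ∸ M
    m = n / (G + G)
    j+n≡i+k : j + n ≡ i + k
    j+n≡i+k = trans (+-assoc i M n) (cong (i +_) (m+[n∸m]≡n M≤k))
    few-blocks : m * (G * G) < L
    few-blocks = +-cancelˡ-< (a j) _ _ (begin-strict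
      a j + m * (G * G)      ≤⟨ grows ⟩
      a (j + m * (G + G))    ≤⟨ a-mono (subst (j + m * (G + G) ≤_) j+n≡i+k (+-monoʳ-≤ j (m/n*n≤m n (G + G)))) ⟩
      a (i + k)              <⟨ aᵢ₊ₖ<x+L ⟩
      x + L                  ≤⟨ +-monoˡ-≤ L (≤-trans x≤aᵢ (a-mono (m≤m+n i M))) ⟩
      a j + L                ∎)
      where open ≤-Reasoning
    enough-blocks : suc k ≤ suc m * (G + G) + M
    enough-blocks = begin
      suc k                                  ≡⟨ cong suc (sym (m∸n+n≡m M≤k)) ⟩
      suc n + M                              ≡⟨ cong (λ n′ → suc n′ + M) (m≡m%n+[m/n]*n n (G + G)) ⟩
      suc (n % (G + G) + m * (G + G)) + M    ≤⟨ +-monoˡ-≤ M (+-monoˡ-≤ (m * (G + G)) (m%n<n n (G + G))) ⟩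
      suc m * (G + G) + M                    ∎
      where open ≤-Reasoning

scale : ∀ p q .{{_ : NonZero p}} → p ≤ q → ∃ λ G → 4 * q < G * p × G * p ≤ 5 * q
scale p q p≤q = suc (4 * q / p) , below , +-mono-≤ p≤q (m/n*n≤m (4 * q) p)
  where
  below : 4 * q < p + 4 * q / p * p
  below = begin-strict
    4 * q                        ≡⟨ m≡m%n+[m/n]*n (4 * q) p ⟩
    4 * q % p + 4 * q / p * p    <⟨ +-monoˡ-< _ (m%n<n (4 * q) p) ⟩
    p + 4 * q / p * p            ∎
    where open ≤-Reasoning

density-scaling : ∀ p q G L k → p * L < k * q → 4 * q < G * p → 4 * L < G * k
density-scaling p q G L k pL<kq 4q<Gp = *-cancelʳ-< p (4 * L) (G * k) (begin-strict
  4 * L * p      ≡⟨ solve 2 (λ L p → con 4 :* L :* p := con 4 :* (p :* L)) refl L p ⟩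
  4 * (p * L)    <⟨ *-monoʳ-< 4 pL<kq ⟩
  4 * (k * q)    ≡⟨ solve 2 (λ k q → con 4 :* (k :* q) := k :* (con 4 :* q)) refl k q ⟩
  k * (4 * q)    ≤⟨ *-monoʳ-≤ k (<⇒≤ 4q<Gp) ⟩
  k * (G * p)    ≡⟨ solve 3 (λ k G p → k :* (G :* p) := G :* k :* p) refl k G p ⟩
  G * k * p      ∎)
  where open ≤-Reasoning

cube-bound : ∀ g G p q c → g ≤ G * (G * G) → G * p ≤ c * q → g * (p * p * p) ≤ (c * c * c) * (q * q * q)
cube-bound g G p q c g≤G³ Gp≤cq = begin
  g * (p * p * p)                      ≤⟨ *-monoˡ-≤ (p * p * p) g≤G³ ⟩
  G * (G * G) * (p * p * p)            ≡⟨ solve 2 (λ G p → G :* (G :* G) :* (p :* p :* p) := (G :* p) :* (G :* p) :* (G :* p)) refl G p ⟩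
  (G * p) * (G * p) * (G * p)          ≤⟨ *-mono-≤ (*-mono-≤ Gp≤cq Gp≤cq) Gp≤cq ⟩
  (c * q) * (c * q) * (c * q)          ≡⟨ solve 2 (λ c q → (c :* q) :* (c :* q) :* (c :* q) := (c :* c :* c) :* (q :* q :* q)) refl c q ⟩
  (c * c * c) * (q * q * q)            ∎
  where open ≤-Reasoning

_÷_ : ℕ → (d : ℕ) → .{{NonZero d}} → ℚᵘ
m ÷ d = ℤ.+ m ℚᵘ./ d

÷-* : ∀ m n b d .{{_ : NonZero b}} .{{_ : NonZero d}} → (m ÷ b) ℚᵘ.* (n ÷ d) ≡ ((m * n) ÷ (b * d)) {{m*n≢0 b d}}
÷-* m n (suc b) (suc d) = cong (ℚᵘ._/ (suc b * suc d)) (sym (ℤP.pos-* m n))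

÷-≤ : ∀ {m n} b d .{{_ : NonZero b}} .{{_ : NonZero d}} → m * d ≤ n * b → m ÷ b ℚᵘ.≤ n ÷ d
÷-≤ {m} {n} (suc b) (suc d) md≤nb = *≤* (subst₂ ℤ._≤_ (ℤP.pos-* m (suc d)) (ℤP.pos-* n (suc b)) (ℤ.+≤+ md≤nb))

÷-<⁻ : ∀ {m n} b d .{{_ : NonZero b}} .{{_ : NonZero d}} → m ÷ b ℚᵘ.< n ÷ d → m * d < n * b
÷-<⁻ {m} {n} (suc b) (suc d) (*<* md<nb) =
  ℤP.drop‿+<+ (subst₂ ℤ._<_ (sym (ℤP.pos-* m (suc d))) (sym (ℤP.pos-* n (suc b))) md<nb)

toℚᵘ-⟦⟧ : ∀ n → toℚᵘ ⟦ n ⟧ ℚᵘ.≃ n ÷ 1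
toℚᵘ-⟦⟧ n = ℚP.toℚᵘ-fromℚᵘ (n ÷ 1)

module _ (p qm : ℕ) .(coprime : Coprime p (suc qm)) where

  private
    q = suc qm
    α = mkℚ (ℤ.+ p) qm coprime

  proper-fraction : α ℚ.< 1ℚ → p < q
  proper-fraction α<1 = subst₂ _<_ (*-identityʳ p) (*-identityˡ q) (÷-<⁻ q 1 (ℚP.toℚᵘ-mono-< α<1))

  fraction-< : ∀ n k → α ℚ.* ⟦ n ⟧ ℚ.< ⟦ k ⟧ → p * n < k * q
  fraction-< n k αn<k = subst₂ _<_ (*-identityʳ (p * n)) (cong (k *_) (*-identityʳ q))
    (÷-<⁻ (q * 1) 1 (ℚᵘP.<-respʳ-≃ (toℚᵘ-⟦⟧ k) (ℚᵘP.<-respˡ-≃ αn≃pn/q (ℚP.toℚᵘ-mono-< αn<k))))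
    where
    open ℚᵘP.≃-Reasoning
    αn≃pn/q : toℚᵘ (α ℚ.* ⟦ n ⟧) ℚᵘ.≃ (p * n) ÷ (q * 1)
    αn≃pn/q = begin
      toℚᵘ (α ℚ.* ⟦ n ⟧)          ≈⟨ ℚP.toℚᵘ-homo-* α ⟦ n ⟧ ⟩
      (p ÷ q) ℚᵘ.* toℚᵘ ⟦ n ⟧     ≈⟨ ℚᵘP.*-congˡ {p ÷ q} (toℚᵘ-⟦⟧ n) ⟩
      (p ÷ q) ℚᵘ.* (n ÷ 1)        ≡⟨ ÷-* p n q 1 ⟩
      (p * n) ÷ (q * 1)           ∎

  fraction-cube-≤ : ∀ g c → g * (p * p * p) ≤ c * (q * q * q) → ⟦ g ⟧ ℚ.* (α ℚ.* α ℚ.* α) ℚ.≤ ⟦ c ⟧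
  fraction-cube-≤ g c gp³≤cq³ = ℚP.toℚᵘ-cancel-≤
    (ℚᵘP.≤-respʳ-≃ (ℚᵘP.≃-sym (toℚᵘ-⟦⟧ c)) (ℚᵘP.≤-respˡ-≃ (ℚᵘP.≃-sym gα³≃gp³/q³)
      (÷-≤ (1 * (q * q * q)) 1 (subst₂ _≤_ (sym (*-identityʳ _)) (cong (c *_) (sym (*-identityˡ _))) gp³≤cq³))))
    where
    open ℚᵘP.≃-Reasoning
    gα³≃gp³/q³ : toℚᵘ (⟦ g ⟧ ℚ.* (α ℚ.* α ℚ.* α)) ℚᵘ.≃ (g * (p * p * p)) ÷ (1 * (q * q * q))
    gα³≃gp³/q³ = begin
      toℚᵘ (⟦ g ⟧ ℚ.* (α ℚ.* α ℚ.* α))                      ≈⟨ ℚP.toℚᵘ-homo-* ⟦ g ⟧ _ ⟩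
      toℚᵘ ⟦ g ⟧ ℚᵘ.* toℚᵘ (α ℚ.* α ℚ.* α)                  ≈⟨ ℚᵘP.*-cong (toℚᵘ-⟦⟧ g) (ℚᵘP.≃-trans (ℚP.toℚᵘ-homo-* (α ℚ.* α) α) (ℚᵘP.*-congʳ {p ÷ q} (ℚP.toℚᵘ-homo-* α α))) ⟩
      (g ÷ 1) ℚᵘ.* ((p ÷ q) ℚᵘ.* (p ÷ q) ℚᵘ.* (p ÷ q))     ≡⟨ cong (λ r → (g ÷ 1) ℚᵘ.* (r ℚᵘ.* (p ÷ q))) (÷-* p p q q) ⟩
      (g ÷ 1) ℚᵘ.* ((p * p) ÷ (q * q) ℚᵘ.* (p ÷ q))        ≡⟨ cong ((g ÷ 1) ℚᵘ.*_) (÷-* (p * p) p (q * q) q) ⟩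
      (g ÷ 1) ℚᵘ.* ((p * p * p) ÷ (q * q * q))             ≡⟨ ÷-* g (p * p * p) 1 (q * q * q) ⟩
      (g * (p * p * p)) ÷ (1 * (q * q * q))                ∎

below-density : ∀ {α β} L k → α ℚ.< β → β ℚ.* ⟦ L ⟧ ℚ.< ⟦ k ⟧ → α ℚ.* ⟦ L ⟧ ℚ.< ⟦ k ⟧
below-density L k α<β βL<k = ℚP.≤-<-trans (ℚP.*-monoʳ-≤-nonNeg ⟦ L ⟧ {{ℚP.normalize-nonNeg L 1}} (ℚP.<⇒≤ α<β)) βL<k

bounded-gaps : ∀ (α : ℚ) → 0ℚ ℚ.< α → α ℚ.< 1ℚ →
               ∀ (a : ℕ → ℕ) → StrictlyIncreasing a → Positive a → UpperBanachDensityGt a α →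
               ∀ (M : ℕ) → ∃₂ λ b b' → M ≤ b × Consecutive a b b' × ⟦ b' ∸ b ⟧ ℚ.* (α ℚ.* α ℚ.* α) ℚ.≤ ⟦ 125 ⟧
bounded-gaps (mkℚ (ℤ.+ zero) _ _) (ℚ.*<* (ℤ.+<+ ())) _ _ _ _ _ _
bounded-gaps (mkℚ ℤ.-[1+ _ ] _ _) (ℚ.*<* ()) _ _ _ _ _ _
bounded-gaps α@(mkℚ (ℤ.+ p@(suc _)) qm coprime) _ α<1 a a-inc a-pos (β , α<β , dense) M
  with scale p (suc qm) (<⇒≤ (proper-fraction p qm coprime α<1))
... | G , 4q<Gp , Gp≤5q with dense (G * G + G * M)
... | x , L , zero , _ , _ , _ , βL<0 with fraction-< p qm coprime L 0 (below-density L 0 α<β βL<0)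
...   | ()
bounded-gaps α@(mkℚ (ℤ.+ p@(suc _)) qm coprime) _ α<1 a a-inc a-pos (β , α<β , dense) M
  | G , 4q<Gp , Gp≤5q | x , L , suc k , room , _ , run , βL<k =
  let pL<kq = fraction-< p qm coprime L (suc k) (below-density L (suc k) α<β βL<k)
      close = dense-interval⇒close-pair a a-inc a-pos G M x L k room run (density-scaling p (suc qm) G L (suc k) pL<kq 4q<Gp)
      b , b' , M≤b , consecutive , gap≤G³ = close-pair⇒consecutive a a-inc a-pos close
  in b , b' , M≤b , consecutive , fraction-cube-≤ p qm coprime (b' ∸ b) 125 (cube-bound (b' ∸ b) G p (suc qm) 5 gap≤G³ Gp≤5q)

theorem1 : ∃ λ (c : ℚ) → (0ℚ ℚ.< c) ×
    (∀ (α : ℚ) → 0ℚ ℚ.< α → α ℚ.< 1ℚ →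
     ∀ (a : ℕ → ℕ) → StrictlyIncreasing a → Positive a →
     UpperBanachDensityGt a α →
     ∀ (M : ℕ) → ∃ λ (b : ℕ) → ∃ λ (b' : ℕ) →
       (M ≤ b) × Consecutive a b b' ×
       (⟦ b' ∸ b ⟧ ℚ.* (α ℚ.* α ℚ.* α) ℚ.≤ c))
theorem1 = ⟦ 125 ⟧ , ℚ.*<* (ℤ.+<+ (s≤s z≤n)) , bounded-gaps
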